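{- For all powers of two $1\le k\le n$, $H(n,k)\le B(n,k)$.
   Context: For a power of two $M$ let $O(M)=\frac M4(\log_2^2M-\log_2M+4)-1$ (size of Batcher's odd-even sorting network). For powers of two $1\le k\le n$, $B(n,k)=\frac14n\log_2^2k+\frac14n\log_2k+2n-\frac12k\log_2k-k-\frac nk$ is the number of comparators of the bitonic selection network $bit\_sel^n_k$ (equivalently $B(n,k)=\frac nkO(k)+(\frac nk-1)(k+\frac{k\log_2k}{2})$), and $H(n,k)$, the number of comparators of the improved pairwise selection network $pw\_hbit\_sel^n_k$, is defined by $H(n,1)=n-1$; $H(n,n)=O(n)$ for $n>1$; $H(n,k)=H(n/2,k)+H(n/2,k/2)+\frac n2+\frac{k\log_2k}{2}$ for $1<k<n$. -}

module Defs where

open import Data.Nat as ℕ using (ℕ; zero; suc; _^_; _<ᵇ_)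
open import Data.Nat.Properties using (m^n≢0)
open import Data.Bool using (if_then_else_)
open import Data.Integer using (+_)
open import Data.Rational using (ℚ; _+_; _*_; _-_; _/_)

ι : ℕ → ℚ
ι m = (+ m) / 1

-- Powers of two are represented by their exponents:
-- M = 2 ^ m, n = 2 ^ a, k = 2 ^ b, so log₂ M = m, log₂ n = a, log₂ k = b.

O : ℕ → ℚ
O m = ι (2 ^ m) * ((+ 1) / 4) * (ι (m ℕ.* m) - ι m + ι 4) - ι 1

B : ℕ → ℕ → ℚ
B a b = ι n * ι (b ℕ.* b) * q4 + ι n * ι b * q4 + ι 2 * ι n
        - ι k * ι b * q2 - ι k - ι n * ((+ 1) / k)
  where
  n = 2 ^ a
  k = 2 ^ b
  q4 = (+ 1) / 4
  q2 = (+ 1) / 2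
  instance
    _ : ℕ.NonZero (2 ^ b)
    _ = m^n≢0 2 b

-- H(n,k) with n = 2 ^ a, k = 2 ^ b (meaningful for b ≤ a):
--   H(n,1) = n − 1
--   H(n,n) = O(n)                     for n > 1
--   H(n,k) = H(n/2,k) + H(n/2,k/2) + n/2 + (k log k)/2   for 1 < k < n
H : ℕ → ℕ → ℚ
H a zero = ι (2 ^ a) - ι 1
H zero (suc b) = O zero   -- outside the range b ≤ a; never used by the statement
H (suc a) (suc b) =
  if b <ᵇ a
  then H a (suc b) + H a b + ι (2 ^ a) + ι (2 ^ b ℕ.* suc b)
  else O (suc a)

-- At k = 1 and k = n the bound is an equality:
-- H(n,1) = n − 1 = B(n,1) and H(n,n) = O(n) = B(n,n). In the recursive case it suffices that B
-- satisfies the recurrence of H with ≥. Once n/k is treated as a variable of its own (it is a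
-- power of two), B is a polynomial, and for β = log k one finds
--   B(2n,2k) − B(n,2k) − B(n,k) − n − k(1 + β) = ((β − 1) n + n/k − β k) / 2,
-- which is nonnegative as soon as n ≥ 2k.
module Submission where

open import Defs
open import Data.Nat using (ℕ; _≤_)
open import Data.Rational using () renaming (_≤_ to _≤ℚ_)

open import Data.Bool using (true; false)
open import Data.Empty using (⊥-elim)
open import Data.Integer as ℤ using (+_)
import Data.Integer.Properties as ℤ
open import Data.Nat as ℕ using (zero; suc; _<_; _<ᵇ_; _^_; s≤s; NonZero)
import Data.Nat.Properties as ℕ
import Data.Nat.Solver as ℕ-Solver
open import Data.Rational using (ℚ; _+_; _*_; _-_; _/_; -_; 0ℚ; 1ℚ; NonNegative; toℚᵘ)
open import Data.Rational.Properties
import Data.Rational.Solver as ℚ-Solver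
open import Data.Rational.Unnormalised as ℚᵘ using (mkℚᵘ; *≡*; *≤*) renaming (_≃_ to _≃ᵘ_)
import Data.Rational.Unnormalised.Properties as ℚᵘ
open import Data.Sum using (inj₁; inj₂)
open import Function using (id)
open import Relation.Binary.PropositionalEquality

-- With n = 2 ^ (b + 1) * m and k = 2 ^ b this is twice the slack above, moved so as to avoid subtraction.
slack-nonNeg : ∀ b m .{{_ : NonZero m}} → 2 ^ suc b ℕ.* m ℕ.+ b ℕ.* 2 ^ b ≤ b ℕ.* (2 ^ suc b ℕ.* m) ℕ.+ 2 ℕ.* m
slack-nonNeg zero          m       = ℕ.≤-reflexive (ℕ.+-identityʳ (2 ℕ.* m))
slack-nonNeg (suc zero)    (suc m) = ℕ.≤-trans (ℕ.m≤m+n _ _) (ℕ.≤-reflexive (solve 1 (λ m →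
  con 4 :* (con 1 :+ m) :+ con 2 :+ con 2 :* m
    := con 1 :* (con 4 :* (con 1 :+ m)) :+ con 2 :* (con 1 :+ m)) refl m))
  where open ℕ-Solver.+-*-Solver
slack-nonNeg (suc (suc b)) (suc m) = ℕ.≤-trans (ℕ.m≤m+n _ _) (ℕ.≤-reflexive (solve 3 (λ b K m →
  8K K :* (con 1 :+ m) :+ (con 2 :+ b) :* 4K K
      :+ (con 8 :* K :* m :+ con 4 :* b :* K :+ con 8 :* b :* K :* m :+ con 2 :+ con 2 :* m)
    := (con 2 :+ b) :* (8K K :* (con 1 :+ m)) :+ con 2 :* (con 1 :+ m)) refl b (2 ^ b) m))
  where
  open ℕ-Solver.+-*-Solver
  4K 8K : ∀ {n} → Polynomial n → Polynomial n
  4K K = con 2 :* (con 2 :* K)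
  8K K = con 2 :* 4K K

toℚᵘ-ι : ∀ m → toℚᵘ (ι m) ≃ᵘ mkℚᵘ (+ m) 0
toℚᵘ-ι m = toℚᵘ-fromℚᵘ (mkℚᵘ (+ m) 0)

ι-+ : ∀ m n → ι (m ℕ.+ n) ≡ ι m + ι n
ι-+ m n = toℚᵘ-injective (begin
  toℚᵘ (ι (m ℕ.+ n))              ≈⟨ toℚᵘ-ι (m ℕ.+ n) ⟩
  mkℚᵘ (+ (m ℕ.+ n)) 0            ≈⟨ *≡* (trans (ℤ.*-identityʳ _) (trans (ℤ.pos-+ m n) (sym sum-over-1))) ⟩
  mkℚᵘ (+ m) 0 ℚᵘ.+ mkℚᵘ (+ n) 0  ≈⟨ ℚᵘ.+-cong (toℚᵘ-ι m) (toℚᵘ-ι n) ⟨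
  toℚᵘ (ι m) ℚᵘ.+ toℚᵘ (ι n)      ≈⟨ toℚᵘ-homo-+ (ι m) (ι n) ⟨
  toℚᵘ (ι m + ι n)                ∎)
  where
  open ℚᵘ.≃-Reasoning
  sum-over-1 : (+ m ℤ.* + 1 ℤ.+ + n ℤ.* + 1) ℤ.* + 1 ≡ + m ℤ.+ + n
  sum-over-1 = trans (ℤ.*-identityʳ _) (cong₂ ℤ._+_ (ℤ.*-identityʳ (+ m)) (ℤ.*-identityʳ (+ n)))

ι-* : ∀ m n → ι (m ℕ.* n) ≡ ι m * ι n
ι-* m n = toℚᵘ-injective (begin
  toℚᵘ (ι (m ℕ.* n))              ≈⟨ toℚᵘ-ι (m ℕ.* n) ⟩
  mkℚᵘ (+ (m ℕ.* n)) 0            ≈⟨ *≡* (cong (ℤ._* + 1) (ℤ.pos-* m n)) ⟩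
  mkℚᵘ (+ m) 0 ℚᵘ.* mkℚᵘ (+ n) 0  ≈⟨ ℚᵘ.*-cong (toℚᵘ-ι m) (toℚᵘ-ι n) ⟨
  toℚᵘ (ι m) ℚᵘ.* toℚᵘ (ι n)      ≈⟨ toℚᵘ-homo-* (ι m) (ι n) ⟨
  toℚᵘ (ι m * ι n)                ∎)
  where open ℚᵘ.≃-Reasoning

ι-mono-≤ : ∀ {m n} → m ≤ n → ι m ≤ℚ ι n
ι-mono-≤ {m} {n} m≤n = toℚᵘ-cancel-≤
  (ℚᵘ.≤-respˡ-≃ (ℚᵘ.≃-sym (toℚᵘ-ι m)) (ℚᵘ.≤-respʳ-≃ (ℚᵘ.≃-sym (toℚᵘ-ι n))
    (*≤* (ℤ.*-monoʳ-≤-nonNeg (+ 1) (ℤ.+≤+ m≤n)))))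

ι[d]*1/d≡1 : ∀ d .{{_ : NonZero d}} → ι d * (+ 1 / d) ≡ 1ℚ
ι[d]*1/d≡1 d@(suc d-1) = toℚᵘ-injective (begin
  toℚᵘ (ι d * (+ 1 / d))              ≈⟨ toℚᵘ-homo-* (ι d) (+ 1 / d) ⟩
  toℚᵘ (ι d) ℚᵘ.* toℚᵘ (+ 1 / d)      ≈⟨ ℚᵘ.*-cong (toℚᵘ-ι d) (toℚᵘ-fromℚᵘ (mkℚᵘ (+ 1) d-1)) ⟩
  mkℚᵘ (+ d) 0 ℚᵘ.* mkℚᵘ (+ 1) d-1    ≈⟨ *≡* (trans (ℤ.*-identityʳ _) (trans (ℤ.*-identityʳ _) (sym d-over-1))) ⟩
  ℚᵘ.1ℚᵘ                              ∎)
  where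
  open ℚᵘ.≃-Reasoning
  d-over-1 : + 1 ℤ.* (+ (1 ℕ.* d)) ≡ + d
  d-over-1 = trans (ℤ.*-identityˡ _) (cong +_ (ℕ.*-identityˡ d))

ι[k*m]*1/k≡ι[m] : ∀ k m .{{_ : NonZero k}} → ι (k ℕ.* m) * (+ 1 / k) ≡ ι m
ι[k*m]*1/k≡ι[m] k m = begin
  ι (k ℕ.* m) * (+ 1 / k)   ≡⟨ cong (_* (+ 1 / k)) (trans (ι-* k m) (*-comm (ι k) (ι m))) ⟩
  ι m * ι k * (+ 1 / k)     ≡⟨ *-assoc (ι m) (ι k) (+ 1 / k) ⟩
  ι m * (ι k * (+ 1 / k))   ≡⟨ cong (ι m *_) (ι[d]*1/d≡1 k) ⟩
  ι m * 1ℚ                  ≡⟨ *-identityʳ (ι m) ⟩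
  ι m                       ∎
  where open ≡-Reasoning

p≤q⇒r≤r+[q-p]*s : ∀ {p q} r s .{{_ : NonNegative s}} → p ≤ℚ q → r ≤ℚ r + (q - p) * s
p≤q⇒r≤r+[q-p]*s {p} {q} r s p≤q = begin
  r                ≡⟨ +-identityʳ r ⟨
  r + 0ℚ           ≡⟨ cong (λ z → r + z) (*-zeroˡ s) ⟨
  r + 0ℚ * s       ≡⟨ cong (λ z → r + z * s) (+-inverseʳ p) ⟨
  r + (p - p) * s  ≤⟨ +-monoʳ-≤ r (*-monoʳ-≤-nonNeg s (+-monoˡ-≤ (- p) p≤q)) ⟩
  r + (q - p) * s  ∎
  where open ≤-Reasoning

¼ ½ : ℚ
¼ = + 1 / 4
½ = + 1 / 2

-- Defs.B over an arbitrary carrier, so that it is both a rational (Bℚ) and a ring-solver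
-- polynomial (Bᴾ). The arguments stand for n, log k, k and n/k.
module _ {A : Set} (add sub mul : A → A → A) (⟨_⟩ : ℚ → A) where

  B-shape : A → A → A → A → A → A
  B-shape n β² β k q = n ⊛ β² ⊛ ⟨ ¼ ⟩ ⊕ n ⊛ β ⊛ ⟨ ¼ ⟩ ⊕ ⟨ ι 2 ⟩ ⊛ n ⊖ k ⊛ β ⊛ ⟨ ½ ⟩ ⊖ k ⊖ q
    where
    infixl 6 _⊕_ _⊖_
    infixl 7 _⊛_
    _⊕_ _⊖_ _⊛_ : A → A → A
    _⊕_ = add
    _⊖_ = sub
    _⊛_ = mul

  B-poly : A → A → A → A → A
  B-poly n β = B-shape n (mul β β) β

Bℚ : ℚ → ℚ → ℚ → ℚ → ℚ
Bℚ = B-poly _+_ _-_ _*_ id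

B≡Bℚ : ∀ {a} b c → b ℕ.+ c ≡ a → B a b ≡ Bℚ (ι (2 ^ a)) (ι b) (ι (2 ^ b)) (ι (2 ^ c))
B≡Bℚ {a} b c refl = cong₂ (λ β² q → B-shape _+_ _-_ _*_ id (ι (2 ^ a)) β² (ι b) (ι (2 ^ b)) q)
  (ι-* b b) (trans (cong (λ N → ι N * (+ 1 / 2 ^ b)) (ℕ.^-distribˡ-+-* 2 b c)) (ι[k*m]*1/k≡ι[m] (2 ^ b) (2 ^ c)))
  where instance _ = ℕ.m^n≢0 2 b

module ℚS = ℚ-Solver.+-*-Solver
open ℚS using (_:=_; con; _:+_; _:*_; _:-_)

Bᴾ : ∀ {m} → ℚS.Polynomial m → ℚS.Polynomial m → ℚS.Polynomial m → ℚS.Polynomial m → ℚS.Polynomial m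
Bᴾ = B-poly _:+_ _:-_ _:*_ con

B-base : ∀ a → B a 0 ≡ ι (2 ^ a) - ι 1
B-base a = trans (B≡Bℚ 0 a refl)
  (ℚS.solve 1 (λ n → Bᴾ n (con (ι 0)) (con (ι 1)) n := n :- con (ι 1)) refl (ι (2 ^ a)))

B-diag : ∀ a → B a a ≡ O a
B-diag a = begin
  B a a                                      ≡⟨ B≡Bℚ a 0 (ℕ.+-identityʳ a) ⟩
  Bℚ n α n (ι 1)
    ≡⟨ ℚS.solve 2 (λ n α → Bᴾ n α n (con (ι 1)) := n :* con ¼ :* (α :* α :- α :+ con (ι 4)) :- con (ι 1)) refl n α ⟩
  n * ¼ * (α * α - α + ι 4) - ι 1            ≡⟨ cong (λ α² → n * ¼ * (α² - α + ι 4) - ι 1) (ι-* a a) ⟨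
  O a                                        ∎
  where
  open ≡-Reasoning
  n = ι (2 ^ a)
  α = ι a

Bℚ-split : ∀ n β k q →
  Bℚ (ι 2 * n) (ι 1 + β) (ι 2 * k) (ι 2 * q)
    ≡ Bℚ n (ι 1 + β) (ι 2 * k) q + Bℚ n β k (ι 2 * q) + n + k * (ι 1 + β)
      + ((β * n + ι 2 * q) - (n + β * k)) * ½
Bℚ-split = ℚS.solve 4 (λ n β k q →
  Bᴾ (two :* n) (one :+ β) (two :* k) (two :* q)
    := Bᴾ n (one :+ β) (two :* k) q :+ Bᴾ n β k (two :* q) :+ n :+ k :* (one :+ β)
       :+ ((β :* n :+ two :* q) :- (n :+ β :* k)) :* con ½) refl
  where
  one two : ∀ {m} → ℚS.Polynomial m
  one = con (ι 1)
  two = con (ι 2)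

H-diag : ∀ a → H (suc a) (suc a) ≡ O (suc a)
H-diag a with a <ᵇ a | ℕ.<ᵇ⇒< a a
... | false | _   = refl
... | true  | a<a = ⊥-elim (ℕ.n≮n a (a<a _))

H-step : ∀ {a b} → b < a → H (suc a) (suc b) ≡ H a (suc b) + H a b + ι (2 ^ a) + ι (2 ^ b ℕ.* suc b)
H-step {a} {b} b<a with b <ᵇ a | ℕ.<⇒<ᵇ b<a
... | true | _ = refl

B-step : ∀ {a b} → b < a → B a (suc b) + B a b + ι (2 ^ a) + ι (2 ^ b ℕ.* suc b) ≤ℚ B (suc a) (suc b)
B-step {a} {b} b<a = begin
  B a (suc b) + B a b + n + ι (2 ^ b ℕ.* suc b)
    ≡⟨ cong₂ _+_ (cong₂ _+_ (cong₂ _+_ B[a,1+b] B[a,b]) refl) (trans (ι-* (2 ^ b) (suc b)) (cong (k *_) (ι-+ 1 b))) ⟩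
  Bℚ n (ι 1 + β) (ι 2 * k) q + Bℚ n β k (ι 2 * q) + n + k * (ι 1 + β)
    ≤⟨ p≤q⇒r≤r+[q-p]*s _ ½ slack ⟩
  _ ≡⟨ Bℚ-split n β k q ⟨
  Bℚ (ι 2 * n) (ι 1 + β) (ι 2 * k) (ι 2 * q)
    ≡⟨ B[1+a,1+b] ⟨
  B (suc a) (suc b) ∎
  where
  open ≤-Reasoning
  c = a ℕ.∸ suc b
  1+b+c≡a : suc b ℕ.+ c ≡ a
  1+b+c≡a = ℕ.m+[n∸m]≡n b<a
  b+1+c≡a : b ℕ.+ suc c ≡ a
  b+1+c≡a = trans (ℕ.+-suc b c) 1+b+c≡a
  n = ι (2 ^ a)
  β = ι b
  k = ι (2 ^ b)
  q = ι (2 ^ c)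
  B[a,1+b] : B a (suc b) ≡ Bℚ n (ι 1 + β) (ι 2 * k) q
  B[a,1+b] = trans (B≡Bℚ (suc b) c 1+b+c≡a) (cong₂ (λ β′ k′ → Bℚ n β′ k′ q) (ι-+ 1 b) (ι-* 2 (2 ^ b)))
  B[a,b] : B a b ≡ Bℚ n β k (ι 2 * q)
  B[a,b] = trans (B≡Bℚ b (suc c) b+1+c≡a) (cong (Bℚ n β k) (ι-* 2 (2 ^ c)))
  B[1+a,1+b] : B (suc a) (suc b) ≡ Bℚ (ι 2 * n) (ι 1 + β) (ι 2 * k) (ι 2 * q)
  B[1+a,1+b] = trans (B≡Bℚ (suc b) (suc c) (cong suc b+1+c≡a))
    (trans (cong₂ (λ n′ β′ → Bℚ n′ β′ (ι (2 ^ suc b)) (ι (2 ^ suc c))) (ι-* 2 (2 ^ a)) (ι-+ 1 b))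
           (cong₂ (Bℚ (ι 2 * n) (ι 1 + β)) (ι-* 2 (2 ^ b)) (ι-* 2 (2 ^ c))))
  slack : n + β * k ≤ℚ β * n + ι 2 * q
  slack = subst₂ _≤ℚ_ (trans (ι-+ (2 ^ a) (b ℕ.* 2 ^ b)) (cong (λ z → n + z) (ι-* b (2 ^ b))))
                    (trans (ι-+ (b ℕ.* 2 ^ a) (2 ℕ.* 2 ^ c)) (cong₂ _+_ (ι-* b (2 ^ a)) (ι-* 2 (2 ^ c))))
    (ι-mono-≤ (subst (λ N → N ℕ.+ b ℕ.* 2 ^ b ≤ b ℕ.* N ℕ.+ 2 ℕ.* 2 ^ c) (sym 2^a≡)
                     (slack-nonNeg b (2 ^ c) {{ℕ.m^n≢0 2 c}})))
    where
    2^a≡ : 2 ^ a ≡ 2 ^ suc b ℕ.* 2 ^ c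
    2^a≡ = trans (cong (2 ^_) (sym 1+b+c≡a)) (ℕ.^-distribˡ-+-* 2 (suc b) c)

lemma6 : (a b : ℕ) → b ≤ a → H a b ≤ℚ B a b
lemma6 a zero _ = ≤-reflexive (sym (B-base a))
lemma6 (suc a) (suc b) (s≤s b≤a) with ℕ.m≤n⇒m<n∨m≡n b≤a
... | inj₂ refl = ≤-reflexive (trans (H-diag a) (sym (B-diag (suc a))))
... | inj₁ b<a  = begin
  H (suc a) (suc b)                                      ≡⟨ H-step b<a ⟩
  H a (suc b) + H a b + ι (2 ^ a) + ι (2 ^ b ℕ.* suc b)
    ≤⟨ +-monoˡ-≤ _ (+-monoˡ-≤ _ (+-mono-≤ (lemma6 a (suc b) b<a) (lemma6 a b b≤a))) ⟩
  B a (suc b) + B a b + ι (2 ^ a) + ι (2 ^ b ℕ.* suc b)  ≤⟨ B-step b<a ⟩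
  B (suc a) (suc b)                                      ∎
  where open ≤-Reasoning
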